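{- Let $2\le m\le n$ be integers. If at least one of $m$ and $n$ is even, then $d_g'(P_n\,\square\,P_m)=2$. Also, $d_g(P_n\,\square\,P_2)=1$.
   Context: $P_n$ denotes the path on $n$ vertices, and $G\,\square\,H$ is the Cartesian product (vertex set $V(G)\times V(H)$, two vertices adjacent if they are equal in one coordinate and adjacent in the other). For a vertex $x$, $N[x]$ denotes its closed neighborhood. The domatic number game on a graph $G$ with palette $[k]=\{1,\dots,k\}$: two players, Alice and Bob, alternately choose a previously unchosen vertex of $G$ and assign it a color from $[k]$, until every vertex has been colored. Let $V_i$ be the set of vertices colored $i$. Alice wins if every $V_i$ ($i\in[k]$) is a dominating set of $G$, i.e. for every vertex $x$ and every color $c\in[k]$ some vertex of $N[x]$ has color $c$; otherwise Bob wins. In the $A$-game Alice moves first; in the $B$-game Bob moves first. The game domatic number $d_g(G)$ is the largest $k$ for which Alice has a winning strategy in the $A$-game with palette $[k]$, and the delayed game domatic number $d_g'(G)$ is the largest $k$ for which Alice has a winning strategy in the $B$-game with palette $[k]$. -}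

module Defs where

open import Data.Nat using (ℕ; zero; suc; _<_; _≤_)
open import Data.Fin using (Fin; toℕ; _≟_)
open import Data.Product using (Σ; ∃; _×_; _,_)
open import Data.Product.Properties using (≡-dec)
open import Data.Sum using (_⊎_)
open import Data.Maybe using (Maybe; just; nothing)
open import Relation.Binary.PropositionalEquality using (_≡_; _≢_)
open import Relation.Nullary using (¬_; Dec; yes; no)
open import Relation.Binary.Definitions using (DecidableEquality)

record Graph : Set₁ where
  field
    V     : Set
    _≟V_  : DecidableEquality V
    Adj   : V → V → Set

PathAdj : (n : ℕ) → Fin n → Fin n → Set
PathAdj n i j = (toℕ j ≡ suc (toℕ i)) ⊎ (toℕ i ≡ suc (toℕ j))

Grid : ℕ → ℕ → Graph
Grid n m = record
  { V    = Fin n × Fin m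
  ; _≟V_ = ≡-dec _≟_ _≟_
  ; Adj  = λ { (i , j) (i' , j') →
               (i ≡ i' × PathAdj m j j') ⊎ (j ≡ j' × PathAdj n i i') }
  }

module Game (G : Graph) (k : ℕ) where
  open Graph G

  InN : V → V → Set
  InN x y = (y ≡ x) ⊎ Adj x y

  Colouring : Set
  Colouring = V → Maybe (Fin k)

  update : Colouring → V → Fin k → Colouring
  update c v col w with w ≟V v
  ... | yes _ = just col
  ... | no  _ = c w

  Full : Colouring → Set
  Full c = ∀ v → ∃ λ col → c v ≡ just col

  AllDominating : Colouring → Set
  AllDominating c = ∀ (x : V) (col : Fin k) → ∃ λ y → InN x y × c y ≡ just col

  data Player : Set where
    alice bob : Player

  -- AliceWins p c : Alice has a winning strategy from position c with p to move.
  data AliceWins : Player → Colouring → Set where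
    finished  : ∀ {p c} → Full c → AllDominating c → AliceWins p c
    aliceMove : ∀ {c} (v : V) → c v ≡ nothing → (col : Fin k) →
                AliceWins bob (update c v col) → AliceWins alice c
    bobMove   : ∀ {c} → ¬ Full c →
                (∀ (v : V) → c v ≡ nothing → (col : Fin k) →
                   AliceWins alice (update c v col)) →
                AliceWins bob c

  empty : Colouring
  empty _ = nothing

  -- Alice wins the A-game (Alice first) / the B-game (Bob first)
  AliceWinsA : Set
  AliceWinsA = AliceWins alice empty

  AliceWinsB : Set
  AliceWinsB = AliceWins bob empty

GameDomaticNumberIs : Graph → ℕ → Set
GameDomaticNumberIs G d =
  Game.AliceWinsA G d × (∀ k → d < k → ¬ Game.AliceWinsA G k)

DelayedGameDomaticNumberIs : Graph → ℕ → Set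
DelayedGameDomaticNumberIs G d =
  Game.AliceWinsB G d × (∀ k → d < k → ¬ Game.AliceWinsB G k)

Even : ℕ → Set
Even n = ∃ λ t → n ≡ t Data.Nat.+ t

{-# OPTIONS --safe #-}
-- With two colours Alice answers each move of Bob at the partner of his vertex in a perfect
-- matching of the grid by dominoes along an even side, using the other colour; every closed
-- neighbourhood then contains a matched pair, hence both colours.  With three or more colours Bob
-- opens at a corner x, whose closed neighbourhood has only three vertices, and colours a second one
-- of them with the same colour, so some colour never reaches N[x].  On the ladder P_n □ P_2 with
-- two or more colours Bob answers every move of Alice on the other vertex of the same rung: on the
-- end rung he copies her colour, on the next rung he uses a different one, and once both rungs are
-- coloured N[x₀] or N[x₁] misses a colour.  With a single colour every full colouring dominates.
module Submission where

open import Defs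
open import Data.Nat using (ℕ; zero; suc; _≤_; _<_; z≤n; s≤s; _+_)
open import Data.Nat.Properties
  using (+-suc; ≤-refl; ≤-trans; <-trans; <-≤-trans; ≤-pred; +-mono-≤; +-mono-≤-<)
open import Data.Fin using (Fin; zero; suc; _≟_)
open import Data.Fin.Properties using (suc-injective)
open import Data.Product using (_×_; _,_; proj₁; proj₂; ∃; ∃₂)
open import Data.Sum using (_⊎_; inj₁; inj₂; map; map₁)
open import Data.Unit using (⊤)
open import Data.Maybe using (Maybe; just; nothing)
open import Data.Maybe.Properties using (just-injective)
open import Data.Maybe.Relation.Binary.Pointwise as Pointwise using (Pointwise)
open import Data.List using (List; []; _∷_; cartesianProduct; allFin)
open import Data.List.Membership.Propositional using (_∈_; lose)
open import Data.List.Membership.Propositional.Properties using (∈-allFin; ∈-cartesianProduct⁺)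
open import Data.List.Relation.Unary.All as All using (All; []; _∷_)
open import Data.List.Relation.Unary.Any using (here; there; any?; satisfied)
open import Relation.Nullary using (¬_; Dec; yes; no; contradiction)
open import Relation.Unary using (Decidable)
open import Function using (_∘_)
open import Relation.Binary.PropositionalEquality
  using (_≡_; _≢_; refl; sym; trans; cong; subst; subst₂; ≢-sym)

record Pairing (V : Set) : Set where
  field
    partner            : V → V
    partner-involutive : ∀ v → partner (partner v) ≡ v
    partner-≢          : ∀ v → partner v ≢ v

  partner-injective : ∀ {u v} → partner u ≡ partner v → u ≡ v
  partner-injective {u} {v} eq =
    trans (sym (partner-involutive u)) (trans (cong partner eq) (partner-involutive v))

record PerfectMatching {V : Set} (Adj : V → V → Set) : Set where
  field
    pairing : Pairing V
  open Pairing pairing public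
  field
    partner-adjacent : ∀ v → Adj v (partner v)

nothing≢just : ∀ {A : Set} {a : A} → nothing ≢ just a
nothing≢just ()

≢nothing⇒just : ∀ {A : Set} (m : Maybe A) → m ≢ nothing → ∃ λ a → m ≡ just a
≢nothing⇒just (just a) _       = a , refl
≢nothing⇒just nothing  m≢noth = contradiction refl m≢noth

other : ∀ {n} → Fin (suc (suc n)) → Fin (suc (suc n))
other zero    = suc zero
other (suc _) = zero

other-≢ : ∀ {n} (α : Fin (suc (suc n))) → other α ≢ α
other-≢ zero    ()
other-≢ (suc _) ()

third : ∀ {n} → Fin (suc (suc (suc n))) → Fin (suc (suc (suc n)))
third zero    = suc zero
third (suc α) = suc (other α)

third-≢0 : ∀ {n} (α : Fin (suc (suc (suc n)))) → third α ≢ zero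
third-≢0 zero    ()
third-≢0 (suc _) ()

third-≢ : ∀ {n} (α : Fin (suc (suc (suc n)))) → third α ≢ α
third-≢ zero    ()
third-≢ (suc α) eq = other-≢ α (suc-injective eq)

fin2-covered : ∀ {α β : Fin 2} → α ≢ β → ∀ γ → γ ≡ α ⊎ γ ≡ β
fin2-covered {zero}     {zero}     α≢β _          = contradiction refl α≢β
fin2-covered {zero}     {suc zero} _   zero       = inj₁ refl
fin2-covered {zero}     {suc zero} _   (suc zero) = inj₂ refl
fin2-covered {suc zero} {zero}     _   zero       = inj₂ refl
fin2-covered {suc zero} {zero}     _   (suc zero) = inj₁ refl
fin2-covered {suc zero} {suc zero} α≢β _          = contradiction refl α≢β

module FiniteGame (G : Graph) (vertices : List (Graph.V G))
                  (∈-vertices : ∀ v → v ∈ vertices) where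
  open Graph G

  module Play (k : ℕ) where
    open Game G k public

    update-≡ : ∀ c v col → update c v col v ≡ just col
    update-≡ c v col with v ≟V v
    ... | yes _   = refl
    ... | no v≢v = contradiction refl v≢v

    update-≢ : ∀ c {v} col {w} → w ≢ v → update c v col w ≡ c w
    update-≢ c {v} col {w} w≢v with w ≟V v
    ... | yes w≡v = contradiction w≡v w≢v
    ... | no _    = refl

    update-coloured : ∀ {c v w d} col → c v ≡ nothing → c w ≡ just d →
                      update c v col w ≡ just d
    update-coloured {c} col cv cw =
      trans (update-≢ c col λ { refl → nothing≢just (trans (sym cv) cw) }) cw

    uncoloured⇒¬Full : ∀ {c v} → c v ≡ nothing → ¬ Full c
    uncoloured⇒¬Full {v = v} cv full with full v
    ... | _ , cv′ = nothing≢just (trans (sym cv) cv′)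

    uncoloured? : (c : Colouring) → Decidable (λ v → c v ≡ nothing)
    uncoloured? c v with c v
    ... | nothing = yes refl
    ... | just _  = no λ ()

    full-or-uncoloured : ∀ c → Full c ⊎ ∃ λ v → c v ≡ nothing
    full-or-uncoloured c with any? (uncoloured? c) vertices
    ... | yes some = inj₂ (satisfied some)
    ... | no none  = inj₁ λ v → ≢nothing⇒just (c v) λ cv → none (lose (∈-vertices v) cv)

    weight : Maybe (Fin k) → ℕ
    weight nothing  = 1
    weight (just _) = 0

    uncolouredAmong : Colouring → List V → ℕ
    uncolouredAmong c []       = 0
    uncolouredAmong c (w ∷ ws) = weight (c w) + uncolouredAmong c ws

    weight-update : ∀ c v col w → weight (update c v col w) ≤ weight (c w)
    weight-update c v col w with w ≟V v
    ... | yes _ = z≤n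
    ... | no _  = ≤-refl

    uncolouredAmong-update-≤ : ∀ c v col ws →
                               uncolouredAmong (update c v col) ws ≤ uncolouredAmong c ws
    uncolouredAmong-update-≤ c v col []       = z≤n
    uncolouredAmong-update-≤ c v col (w ∷ ws) =
      +-mono-≤ (weight-update c v col w) (uncolouredAmong-update-≤ c v col ws)

    uncolouredAmong-update-< : ∀ {c v} col {ws} → c v ≡ nothing → v ∈ ws →
                               uncolouredAmong (update c v col) ws < uncolouredAmong c ws
    uncolouredAmong-update-< {c} {v} col {_ ∷ ws} cv (here refl)
      rewrite update-≡ c v col | cv = s≤s (uncolouredAmong-update-≤ c v col ws)
    uncolouredAmong-update-< {c} {v} col {w ∷ _} cv (there v∈ws) =
      +-mono-≤-< (weight-update c v col w) (uncolouredAmong-update-< col cv v∈ws)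

    #uncoloured : Colouring → ℕ
    #uncoloured c = uncolouredAmong c vertices

    #uncoloured-update : ∀ {c v} col → c v ≡ nothing →
                         #uncoloured (update c v col) < #uncoloured c
    #uncoloured-update {v = v} col cv = uncolouredAmong-update-< col cv (∈-vertices v)

    ColouredOtherThan : Fin k → Colouring → V → Set
    ColouredOtherThan z c y = ∃ λ d → c y ≡ just d × d ≢ z

    Blocked : Colouring → Set
    Blocked c = ∃₂ λ x z → ∀ y → InN x y → ColouredOtherThan z c y

    blocked-update : ∀ {c v} col → c v ≡ nothing → Blocked c → Blocked (update c v col)
    blocked-update col cv (x , z , blocked) = x , z , λ y y∈N[x] →
      let d , cy , d≢z = blocked y y∈N[x] in d , update-coloured col cv cy , d≢z

    Blocked⇒¬AliceWins : ∀ {p c} → Blocked c → ¬ AliceWins p c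
    Blocked⇒¬AliceWins (x , z , blocked) (finished _ dominating) with dominating x z
    ... | y , y∈N[x] , cy with blocked y y∈N[x]
    ... | d , cy′ , d≢z = d≢z (just-injective (trans (sym cy′) cy))
    Blocked⇒¬AliceWins b (aliceMove v cv col win) =
      Blocked⇒¬AliceWins (blocked-update col cv b) win
    Blocked⇒¬AliceWins {c = c} b@(_ , z , _) (bobMove ¬full win) with full-or-uncoloured c
    ... | inj₁ full    = ¬full full
    ... | inj₂ (v , cv) = Blocked⇒¬AliceWins (blocked-update z cv b) (win v cv z)

    blocked-within : ∀ {c x z ys} → (∀ y → Adj x y → y ∈ ys) →
                     ColouredOtherThan z c x → All (ColouredOtherThan z c) ys → Blocked c
    blocked-within N[x]⊆ys cx cys = _ , _ , λ
      { _ (inj₁ refl) → cx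
      ; y (inj₂ adj)  → All.lookup cys (N[x]⊆ys y adj)
      }

    everyFullDominating⇒AliceWins : Fin k → (∀ {c} → Full c → AllDominating c) →
                                    ∀ p c → AliceWins p c
    everyFullDominating⇒AliceWins col₀ dominating p c = go (suc (#uncoloured c)) p c ≤-refl
      where
      go : ∀ fuel p c → #uncoloured c < fuel → AliceWins p c
      go (suc fuel) p c c<fuel with full-or-uncoloured c
      ... | inj₁ full = finished full (dominating full)
      go (suc fuel) alice c c<fuel | inj₂ (v , cv) =
        aliceMove v cv col₀
          (go fuel bob _ (<-≤-trans (#uncoloured-update col₀ cv) (≤-pred c<fuel)))
      go (suc fuel) bob c c<fuel | inj₂ (v , cv) =
        bobMove (uncoloured⇒¬Full cv) λ u cu col →
          go fuel alice _ (<-≤-trans (#uncoloured-update col cu) (≤-pred c<fuel))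

    module _ (Inv : Colouring → Set)
             (inv-dominating : ∀ {c} → Inv c → Full c → AllDominating c)
             (respond : ∀ {c} → Inv c → ∀ v → c v ≡ nothing → ∀ col →
                        ∃₂ λ u col′ → update c v col u ≡ nothing ×
                                      Inv (update (update c v col) u col′))
      where

      invariant⇒AliceWins : ∀ {c} → Inv c → AliceWins bob c
      invariant⇒AliceWins {c} inv = go (suc (#uncoloured c)) c inv ≤-refl
        where
        go : ∀ fuel c → Inv c → #uncoloured c < fuel → AliceWins bob c
        go (suc fuel) c inv c<fuel with full-or-uncoloured c
        ... | inj₁ full     = finished full (inv-dominating inv full)
        ... | inj₂ (_ , cw) = bobMove (uncoloured⇒¬Full cw) λ v cv col →
          let u , col′ , cu , inv′ = respond inv v cv col
          in aliceMove u cu col′ (go fuel _ inv′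
               (<-trans (#uncoloured-update col′ cu)
                        (<-≤-trans (#uncoloured-update col cv) (≤-pred c<fuel))))

    data Response (Inv : Colouring → Set) (c : Colouring) : Set where
      blocked : Blocked c → Response Inv c
      reply   : ∀ u → c u ≡ nothing → ∀ col →
                Inv (update c u col) ⊎ Blocked (update c u col) → Response Inv c

    module _ (Inv : Colouring → Set)
             (inv-¬full : ∀ {c} → Inv c → ¬ Full c)
             (strategy : ∀ {c} → Inv c → ∀ v → c v ≡ nothing → ∀ col →
                         Response Inv (update c v col))
      where

      invariant⇒¬AliceWins : ∀ {c} → Inv c → ¬ AliceWins alice c
      invariant⇒¬AliceWins inv (finished full _)        = inv-¬full inv full
      invariant⇒¬AliceWins inv (aliceMove v cv col win) = respond (strategy inv v cv col) win
        where
        respond : ∀ {c} → Response Inv c → ¬ AliceWins bob c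
        respond (blocked b)                  win               = Blocked⇒¬AliceWins b win
        respond (reply u cu col _)           (finished full _) = uncoloured⇒¬Full cu full
        respond (reply u cu col (inj₁ inv′)) (bobMove _ win)   =
          invariant⇒¬AliceWins inv′ (win u cu col)
        respond (reply u cu col (inj₂ b))    (bobMove _ win)   =
          Blocked⇒¬AliceWins b (win u cu col)

    module _ (P : Pairing V) where
      open Pairing P

      Paired : (Fin k → Fin k → Set) → Colouring → Set
      Paired R c = ∀ v → Pointwise R (c v) (c (partner v))

      updatePair : Colouring → V → Fin k → Fin k → Colouring
      updatePair c v col col′ = update (update c v col) (partner v) col′

      updatePair-at : ∀ c v col col′ → updatePair c v col col′ v ≡ just col
      updatePair-at c v col col′ =
        trans (update-≢ _ col′ (≢-sym (partner-≢ v))) (update-≡ c v col)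

      updatePair-at-partner : ∀ c {v v′} col col′ → partner v ≡ v′ →
                              updatePair c v col col′ v′ ≡ just col′
      updatePair-at-partner c {v} col col′ refl = update-≡ _ (partner v) col′

      updatePair-away : ∀ c {v v′} col col′ {w} → partner v ≡ v′ → w ≢ v → w ≢ v′ →
                        updatePair c v col col′ w ≡ c w
      updatePair-away c col col′ refl w≢v w≢v′ =
        trans (update-≢ _ col′ w≢v′) (update-≢ c col w≢v)

      paired-empty : ∀ {R} → Paired R empty
      paired-empty _ = Pointwise.nothing

      paired-uncoloured : ∀ {R c v} → Paired R c → c v ≡ nothing → c (partner v) ≡ nothing
      paired-uncoloured {R} {c} {v} paired cv =
        Pointwise.nothing-inv (subst (λ m → Pointwise R m (c (partner v))) cv (paired v))

      paired-coloured : ∀ {R c v α} → Paired R c → c v ≡ just α →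
                        ∃ λ β → c (partner v) ≡ just β × R α β
      paired-coloured {R} {c} {v} paired cv =
        Pointwise.just-inv (subst (λ m → Pointwise R m (c (partner v))) cv (paired v))

      partner-uncoloured : ∀ {R c v} col → Paired R c → c v ≡ nothing →
                           update c v col (partner v) ≡ nothing
      partner-uncoloured {c = c} {v} col paired cv =
        trans (update-≢ c col (partner-≢ v)) (paired-uncoloured paired cv)

      paired-updatePair : ∀ {R c} v {col col′} → R col col′ → R col′ col → Paired R c →
                          Paired R (updatePair c v col col′)
      paired-updatePair {R} {c} v {col} {col′} r r′ paired w =
        by-cases (w ≟V v) (w ≟V partner v)
        where
        c′ = updatePair c v col col′
        by-cases : Dec (w ≡ v) → Dec (w ≡ partner v) → Pointwise R (c′ w) (c′ (partner w))
        by-cases (yes refl) _ =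
          subst₂ (Pointwise R) (sym (updatePair-at c v col col′))
                               (sym (updatePair-at-partner c col col′ refl)) (Pointwise.just r)
        by-cases (no _) (yes refl) =
          subst₂ (Pointwise R) (sym (updatePair-at-partner c col col′ refl))
                               (sym (trans (cong c′ (partner-involutive v))
                                           (updatePair-at c v col col′)))
                               (Pointwise.just r′)
        by-cases (no w≢v) (no w≢v′) =
          subst₂ (Pointwise R) (sym (updatePair-away c col col′ refl w≢v w≢v′))
                               (sym (updatePair-away c col col′ refl w′≢v w′≢v′)) (paired w)
          where
          w′≢v : partner w ≢ v
          w′≢v eq = w≢v′ (trans (sym (partner-involutive w)) (cong partner eq))
          w′≢v′ : partner w ≢ partner v
          w′≢v′ eq = w≢v (partner-injective eq)

  module _ (M : PerfectMatching Adj) where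
    open Play 2
    open PerfectMatching M

    perfectMatching⇒AliceWinsB : AliceWinsB
    perfectMatching⇒AliceWinsB =
      invariant⇒AliceWins (Paired pairing _≢_) dominating respond (paired-empty pairing)
      where
      dominating : ∀ {c} → Paired pairing _≢_ c → Full c → AllDominating c
      dominating paired full x γ with full x
      ... | α , cx with paired-coloured pairing paired cx
      ... | β , cx′ , α≢β with fin2-covered α≢β γ
      ... | inj₁ refl = x , inj₁ refl , cx
      ... | inj₂ refl = partner x , inj₂ (partner-adjacent x) , cx′

      respond : ∀ {c} → Paired pairing _≢_ c → ∀ v → c v ≡ nothing → ∀ col →
                ∃₂ λ u col′ → update c v col u ≡ nothing ×
                              Paired pairing _≢_ (update (update c v col) u col′)
      respond paired v cv col =
        partner v , other col , partner-uncoloured pairing col paired cv ,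
        paired-updatePair pairing v (≢-sym (other-≢ col)) (other-≢ col) paired

  module _ (k : ℕ) {x y z : V} (y≢x : y ≢ x) (z≢x : z ≢ x) (z≢y : z ≢ y)
           (N[x]⊆ : ∀ w → Adj x w → w ∈ y ∷ z ∷ []) where
    open Play (3 + k)

    data Threat (c : Colouring) : Set where
      x-zero  : c x ≡ just zero → c y ≡ nothing   → c z ≡ nothing → Threat c
      xy-zero : c x ≡ just zero → c y ≡ just zero → c z ≡ nothing → Threat c

    threat-z : ∀ {c} → Threat c → c z ≡ nothing
    threat-z (x-zero _ _ cz)  = cz
    threat-z (xy-zero _ _ cz) = cz

    blocked-twoColours : ∀ {c α} → c x ≡ just zero →
                         (c y ≡ just zero × c z ≡ just α) ⊎ (c y ≡ just α × c z ≡ just zero) →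
                         Blocked c
    blocked-twoColours {α = α} cx (inj₁ (cy , cz)) =
      blocked-within N[x]⊆ (zero , cx , 0≢third)
                           ((zero , cy , 0≢third) ∷ (α , cz , ≢-sym (third-≢ α)) ∷ [])
      where 0≢third = ≢-sym (third-≢0 α)
    blocked-twoColours {α = α} cx (inj₂ (cy , cz)) =
      blocked-within N[x]⊆ (zero , cx , 0≢third)
                           ((α , cy , ≢-sym (third-≢ α)) ∷ (zero , cz , 0≢third) ∷ [])
      where 0≢third = ≢-sym (third-≢0 α)

    threatStrategy : ∀ {c} → Threat c → ∀ v → c v ≡ nothing → ∀ col →
                     Response Threat (update c v col)
    threatStrategy {c} threat v cv col = by-cases threat (v ≟V z) (v ≟V y)
      where
      c′ = update c v col
      cv′ : c′ v ≡ just col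
      cv′ = update-≡ c v col
      keep : ∀ {w α} → c w ≡ just α → c′ w ≡ just α
      keep = update-coloured col cv
      by-cases : Threat c → Dec (v ≡ z) → Dec (v ≡ y) → Response Threat c′
      by-cases (x-zero cx cy cz) (yes refl) _ =
        reply y cy′ zero (inj₂ (blocked-twoColours (update-coloured zero cy′ (keep cx))
                                  (inj₁ (update-≡ c′ y zero , update-coloured zero cy′ cv′))))
        where cy′ = trans (update-≢ c col (≢-sym z≢y)) cy
      by-cases (x-zero cx cy cz) (no v≢z) (yes refl) =
        reply z cz′ zero (inj₂ (blocked-twoColours (update-coloured zero cz′ (keep cx))
                                  (inj₂ (update-coloured zero cz′ cv′ , update-≡ c′ z zero))))
        where cz′ = trans (update-≢ c col z≢y) cz
      by-cases (x-zero cx cy cz) (no v≢z) (no v≢y) =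
        reply y cy′ zero (inj₁ (xy-zero (update-coloured zero cy′ (keep cx)) (update-≡ c′ y zero)
                                        (trans (update-≢ c′ zero z≢y) cz′)))
        where
        cy′ = trans (update-≢ c col (≢-sym v≢y)) cy
        cz′ = trans (update-≢ c col (≢-sym v≢z)) cz
      by-cases (xy-zero cx cy cz) (yes refl) _ =
        blocked (blocked-twoColours (keep cx) (inj₁ (keep cy , cv′)))
      by-cases (xy-zero cx cy cz) (no _) (yes refl) =
        contradiction (trans (sym cv) cy) nothing≢just
      by-cases (xy-zero cx cy cz) (no v≢z) (no v≢y) =
        reply z cz′ zero (inj₂ (blocked-twoColours (update-coloured zero cz′ (keep cx))
                                  (inj₁ (update-coloured zero cz′ (keep cy) , update-≡ c′ z zero))))
        where cz′ = trans (update-≢ c col (≢-sym v≢z)) cz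

    lowDegree⇒¬AliceWinsB : ¬ AliceWinsB
    lowDegree⇒¬AliceWinsB (finished full _) = uncoloured⇒¬Full {v = x} refl full
    lowDegree⇒¬AliceWinsB (bobMove _ win) =
      invariant⇒¬AliceWins Threat (uncoloured⇒¬Full ∘ threat-z) threatStrategy
                           opening (win x refl zero)
      where
      opening : Threat (update empty x zero)
      opening =
        x-zero (update-≡ empty x zero) (update-≢ empty zero y≢x) (update-≢ empty zero z≢x)

  record LadderEnd (P : Pairing V) : Set where
    open Pairing P
    field
      x₀ x₁ y₀ y₁ : V
      partner-x₀  : partner x₀ ≡ x₁
      partner-y₀  : partner y₀ ≡ y₁
      x₀≢y₀       : x₀ ≢ y₀
      x₀≢y₁       : x₀ ≢ y₁
      x₁≢y₀       : x₁ ≢ y₀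
      x₁≢y₁       : x₁ ≢ y₁
      N[x₀]⊆      : ∀ w → Adj x₀ w → w ∈ x₁ ∷ y₀ ∷ []
      N[x₁]⊆      : ∀ w → Adj x₁ w → w ∈ x₀ ∷ y₁ ∷ []

    partner-x₁ : partner x₁ ≡ x₀
    partner-x₁ = trans (cong partner (sym partner-x₀)) (partner-involutive x₀)

    partner-y₁ : partner y₁ ≡ y₀
    partner-y₁ = trans (cong partner (sym partner-y₀)) (partner-involutive y₀)

  mirror : ∀ {P} → LadderEnd P → LadderEnd P
  mirror E = record
    { x₀ = x₁ ; x₁ = x₀ ; y₀ = y₁ ; y₁ = y₀
    ; partner-x₀ = partner-x₁ ; partner-y₀ = partner-y₁
    ; x₀≢y₀ = x₁≢y₁ ; x₀≢y₁ = x₁≢y₀ ; x₁≢y₀ = x₀≢y₁ ; x₁≢y₁ = x₀≢y₀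
    ; N[x₀]⊆ = N[x₁]⊆ ; N[x₁]⊆ = N[x₀]⊆
    }
    where open LadderEnd E

  module _ (k : ℕ) (P : Pairing V) where
    open Play (2 + k)
    open Pairing P

    data RungState (x₀ x₁ y₀ y₁ : V) (c : Colouring) : Set where
      fresh    : c x₀ ≡ nothing → c x₁ ≡ nothing → c y₀ ≡ nothing → c y₁ ≡ nothing →
                 RungState x₀ x₁ y₀ y₁ c
      endRung  : ∀ α → c x₀ ≡ just α → c x₁ ≡ just α → c y₀ ≡ nothing → c y₁ ≡ nothing →
                 RungState x₀ x₁ y₀ y₁ c
      nextRung : ∀ α β → α ≢ β → c y₀ ≡ just α → c y₁ ≡ just β →
                 c x₀ ≡ nothing → c x₁ ≡ nothing → RungState x₀ x₁ y₀ y₁ c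

    rungState-mirror : ∀ {x₀ x₁ y₀ y₁ c} → RungState x₀ x₁ y₀ y₁ c → RungState x₁ x₀ y₁ y₀ c
    rungState-mirror (fresh cx₀ cx₁ cy₀ cy₁)     = fresh cx₁ cx₀ cy₁ cy₀
    rungState-mirror (endRung α cx₀ cx₁ cy₀ cy₁) = endRung α cx₁ cx₀ cy₁ cy₀
    rungState-mirror (nextRung α β α≢β cy₀ cy₁ cx₀ cx₁) =
      nextRung β α (≢-sym α≢β) cy₁ cy₀ cx₁ cx₀

    rungState-cong : ∀ {x₀ x₁ y₀ y₁ c c′} →
                     c′ x₀ ≡ c x₀ → c′ x₁ ≡ c x₁ → c′ y₀ ≡ c y₀ → c′ y₁ ≡ c y₁ →
                     RungState x₀ x₁ y₀ y₁ c → RungState x₀ x₁ y₀ y₁ c′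
    rungState-cong e₀ e₁ f₀ f₁ (fresh cx₀ cx₁ cy₀ cy₁) =
      fresh (trans e₀ cx₀) (trans e₁ cx₁) (trans f₀ cy₀) (trans f₁ cy₁)
    rungState-cong e₀ e₁ f₀ f₁ (endRung α cx₀ cx₁ cy₀ cy₁) =
      endRung α (trans e₀ cx₀) (trans e₁ cx₁) (trans f₀ cy₀) (trans f₁ cy₁)
    rungState-cong e₀ e₁ f₀ f₁ (nextRung α β α≢β cy₀ cy₁ cx₀ cx₁) =
      nextRung α β α≢β (trans f₀ cy₀) (trans f₁ cy₁) (trans e₀ cx₀) (trans e₁ cx₁)

    rungState-¬Full : ∀ {x₀ x₁ y₀ y₁ c} → RungState x₀ x₁ y₀ y₁ c → ¬ Full c
    rungState-¬Full (fresh cx₀ _ _ _)          = uncoloured⇒¬Full cx₀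
    rungState-¬Full (endRung _ _ _ cy₀ _)      = uncoloured⇒¬Full cy₀
    rungState-¬Full (nextRung _ _ _ _ _ cx₀ _) = uncoloured⇒¬Full cx₀

    module LadderMoves (E : LadderEnd P) where
      open LadderEnd E

      Outcome : Colouring → Set
      Outcome c = RungState x₀ x₁ y₀ y₁ c ⊎ Blocked c

      endMove : ∀ {c} → RungState x₀ x₁ y₀ y₁ c → c x₀ ≡ nothing → ∀ col →
                ∃ λ col′ → Outcome (updatePair P c x₀ col col′)
      endMove {c} state cx₀ col = by-cases state
        where
        module _ (col′ : Fin (2 + k)) where
          c″    = updatePair P c x₀ col col′
          c″x₀ = updatePair-at P c x₀ col col′
          c″x₁ = updatePair-at-partner P c col col′ partner-x₀
          c″y₀ = updatePair-away P c col col′ partner-x₀ (≢-sym x₀≢y₀) (≢-sym x₁≢y₀)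
          c″y₁ = updatePair-away P c col col′ partner-x₀ (≢-sym x₀≢y₁) (≢-sym x₁≢y₁)
        by-cases : RungState x₀ x₁ y₀ y₁ c → ∃ λ col′ → Outcome (c″ col′)
        by-cases (fresh _ _ cy₀ cy₁) =
          col , inj₁ (endRung col (c″x₀ col) (c″x₁ col)
                              (trans (c″y₀ col) cy₀) (trans (c″y₁ col) cy₁))
        by-cases (endRung _ cx₀′ _ _ _) = contradiction (trans (sym cx₀) cx₀′) nothing≢just
        by-cases (nextRung α β α≢β cy₀ cy₁ _ _) = col , inj₂ (blocking (col ≟ α))
          where
          blocking : Dec (col ≡ α) → Blocked (c″ col)
          blocking (yes refl) =
            blocked-within N[x₀]⊆ (col , c″x₀ col , α≢β)
                                   ((col , c″x₁ col , α≢β) ∷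
                                    (col , trans (c″y₀ col) cy₀ , α≢β) ∷ [])
          blocking (no col≢α) =
            blocked-within N[x₁]⊆ (col , c″x₁ col , col≢α)
                                   ((col , c″x₀ col , col≢α) ∷
                                    (β , trans (c″y₁ col) cy₁ , ≢-sym α≢β) ∷ [])

      nextMove : ∀ {c} → RungState x₀ x₁ y₀ y₁ c → c y₀ ≡ nothing → ∀ col →
                 ∃ λ col′ → Outcome (updatePair P c y₀ col col′)
      nextMove {c} state cy₀ col = by-cases state
        where
        module _ (col′ : Fin (2 + k)) where
          c″    = updatePair P c y₀ col col′
          c″y₀ = updatePair-at P c y₀ col col′
          c″y₁ = updatePair-at-partner P c col col′ partner-y₀
          c″x₀ = updatePair-away P c col col′ partner-y₀ x₀≢y₀ x₀≢y₁
          c″x₁ = updatePair-away P c col col′ partner-y₀ x₁≢y₀ x₁≢y₁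
        by-cases : RungState x₀ x₁ y₀ y₁ c → ∃ λ col′ → Outcome (c″ col′)
        by-cases (fresh cx₀ cx₁ _ _) =
          other col , inj₁ (nextRung col (other col) (≢-sym (other-≢ col)) (c″y₀ _) (c″y₁ _)
                                     (trans (c″x₀ _) cx₀) (trans (c″x₁ _) cx₁))
        by-cases (endRung α cx₀ cx₁ _ _) =
          α , inj₂ (blocked-within N[x₁]⊆ (α , trans (c″x₁ α) cx₁ , α≢other)
                                           ((α , trans (c″x₀ α) cx₀ , α≢other) ∷
                                            (α , c″y₁ α , α≢other) ∷ []))
          where α≢other = ≢-sym (other-≢ α)
        by-cases (nextRung _ _ _ cy₀′ _ _ _) = contradiction (trans (sym cy₀) cy₀′) nothing≢just

    module _ (E : LadderEnd P) where
      open LadderEnd E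
      open LadderMoves E
      module Mirrored = LadderMoves (mirror E)

      LadderInvariant : Colouring → Set
      LadderInvariant c = Paired P (λ _ _ → ⊤) c × RungState x₀ x₁ y₀ y₁ c

      ladderStrategy : ∀ {c} → LadderInvariant c → ∀ v → c v ≡ nothing → ∀ col →
                       Response LadderInvariant (update c v col)
      ladderStrategy {c} (paired , state) v cv col =
        by-cases (v ≟V x₀) (v ≟V x₁) (v ≟V y₀) (v ≟V y₁)
        where
        respondWith : ∀ col′ → Outcome (updatePair P c v col col′) →
                      Response LadderInvariant (update c v col)
        respondWith col′ outcome =
          reply (partner v) (partner-uncoloured P col paired cv) col′
                (map₁ (paired-updatePair P v _ _ paired ,_) outcome)

        unchanged : ∀ {w w′} → partner w ≡ w′ → v ≢ w → v ≢ w′ →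
                    updatePair P c v col col w ≡ c w
        unchanged {w} refl v≢w v≢w′ =
          updatePair-away P c col col refl (≢-sym v≢w)
            (λ w≡v′ → v≢w′ (trans (sym (partner-involutive v)) (cong partner (sym w≡v′))))

        by-cases : Dec (v ≡ x₀) → Dec (v ≡ x₁) → Dec (v ≡ y₀) → Dec (v ≡ y₁) →
                   Response LadderInvariant (update c v col)
        by-cases (yes refl) _ _ _ =
          let col′ , outcome = endMove state cv col in respondWith col′ outcome
        by-cases (no _) (yes refl) _ _ =
          let col′ , outcome = Mirrored.endMove (rungState-mirror state) cv col
          in respondWith col′ (map₁ rungState-mirror outcome)
        by-cases (no _) (no _) (yes refl) _ =
          let col′ , outcome = nextMove state cv col in respondWith col′ outcome
        by-cases (no _) (no _) (no _) (yes refl) =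
          let col′ , outcome = Mirrored.nextMove (rungState-mirror state) cv col
          in respondWith col′ (map₁ rungState-mirror outcome)
        by-cases (no v≢x₀) (no v≢x₁) (no v≢y₀) (no v≢y₁) =
          respondWith col (inj₁ (rungState-cong (unchanged partner-x₀ v≢x₀ v≢x₁)
                                                (unchanged partner-x₁ v≢x₁ v≢x₀)
                                                (unchanged partner-y₀ v≢y₀ v≢y₁)
                                                (unchanged partner-y₁ v≢y₁ v≢y₀) state))

      ladderEnd⇒¬AliceWinsA : ¬ AliceWinsA
      ladderEnd⇒¬AliceWinsA =
        invariant⇒¬AliceWins LadderInvariant (rungState-¬Full ∘ proj₂) ladderStrategy
                             (paired-empty P , fresh refl refl refl refl)

  module _ where
    open Play 1

    oneColour⇒AliceWinsA : AliceWinsA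
    oneColour⇒AliceWinsA = everyFullDominating⇒AliceWins zero dominating alice empty
      where
      dominating : ∀ {c} → Full c → AllDominating c
      dominating full x zero with full x
      ... | zero , cx = x , inj₁ refl , cx

pathMatching-0 : PerfectMatching (PathAdj 0)
pathMatching-0 = record
  { pairing          = record { partner = λ () ; partner-involutive = λ () ; partner-≢ = λ () }
  ; partner-adjacent = λ ()
  }

pathMatching-2+ : ∀ {n} → PerfectMatching (PathAdj n) → PerfectMatching (PathAdj (suc (suc n)))
pathMatching-2+ {n} M = record
  { pairing          = record
    { partner = partner′ ; partner-involutive = involutive ; partner-≢ = ≢ }
  ; partner-adjacent = adjacent
  }
  where
  open PerfectMatching M
  partner′ : Fin (suc (suc n)) → Fin (suc (suc n))
  partner′ zero          = suc zero
  partner′ (suc zero)    = zero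
  partner′ (suc (suc i)) = suc (suc (partner i))
  involutive : ∀ i → partner′ (partner′ i) ≡ i
  involutive zero          = refl
  involutive (suc zero)    = refl
  involutive (suc (suc i)) = cong (λ (j : Fin n) → suc (suc j)) (partner-involutive i)
  ≢ : ∀ i → partner′ i ≢ i
  ≢ zero          ()
  ≢ (suc zero)    ()
  ≢ (suc (suc i)) eq = partner-≢ i (suc-injective (suc-injective eq))
  adjacent : ∀ i → PathAdj (suc (suc n)) i (partner′ i)
  adjacent zero          = inj₁ refl
  adjacent (suc zero)    = inj₂ refl
  adjacent (suc (suc i)) = map (cong (2 +_)) (cong (2 +_)) (partner-adjacent i)

pathMatching : ∀ n → Even n → PerfectMatching (PathAdj n)
pathMatching _ (t , refl) = doubled t
  where
  doubled : ∀ t → PerfectMatching (PathAdj (t + t))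
  doubled zero    = pathMatching-0
  doubled (suc t) = subst (PerfectMatching ∘ PathAdj) (cong suc (sym (+-suc t t)))
                          (pathMatching-2+ (doubled t))

gridMatchingˡ : ∀ {n m} → PerfectMatching (PathAdj n) → PerfectMatching (Graph.Adj (Grid n m))
gridMatchingˡ M = record
  { pairing = record
    { partner            = λ (i , j) → partner i , j
    ; partner-involutive = λ (i , j) → cong (_, j) (partner-involutive i)
    ; partner-≢          = λ (i , j) eq → partner-≢ i (cong proj₁ eq)
    }
  ; partner-adjacent = λ (i , j) → inj₂ (refl , partner-adjacent i)
  }
  where open PerfectMatching M

gridMatchingʳ : ∀ {n m} → PerfectMatching (PathAdj m) → PerfectMatching (Graph.Adj (Grid n m))
gridMatchingʳ M = record
  { pairing = record
    { partner            = λ (i , j) → i , partner j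
    ; partner-involutive = λ (i , j) → cong (i ,_) (partner-involutive j)
    ; partner-≢          = λ (i , j) eq → partner-≢ j (cong proj₂ eq)
    }
  ; partner-adjacent = λ (i , j) → inj₁ (refl , partner-adjacent j)
  }
  where open PerfectMatching M

pathAdj-0 : ∀ {n} {j : Fin (suc (suc n))} → PathAdj (suc (suc n)) zero j → j ≡ suc zero
pathAdj-0 {j = zero}       (inj₁ ())
pathAdj-0 {j = zero}       (inj₂ ())
pathAdj-0 {j = suc zero}   _ = refl
pathAdj-0 {j = suc (suc _)} (inj₁ ())
pathAdj-0 {j = suc (suc _)} (inj₂ ())

pathAdj₂-1 : ∀ {j : Fin 2} → PathAdj 2 (suc zero) j → j ≡ zero
pathAdj₂-1 {zero}     _ = refl
pathAdj₂-1 {suc zero} (inj₁ ())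
pathAdj₂-1 {suc zero} (inj₂ ())

adj-gridCorner : ∀ {n m} w → Graph.Adj (Grid (suc (suc n)) (suc (suc m))) (zero , zero) w →
                 w ∈ (zero , suc zero) ∷ (suc zero , zero) ∷ []
adj-gridCorner _ (inj₁ (refl , adj)) = here (cong (zero ,_) (pathAdj-0 adj))
adj-gridCorner _ (inj₂ (refl , adj)) = there (here (cong (_, zero) (pathAdj-0 adj)))

adj-ladderCorner : ∀ {n} w → Graph.Adj (Grid (suc (suc n)) 2) (zero , suc zero) w →
                   w ∈ (zero , zero) ∷ (suc zero , suc zero) ∷ []
adj-ladderCorner _ (inj₁ (refl , adj)) = here (cong (zero ,_) (pathAdj₂-1 adj))
adj-ladderCorner _ (inj₂ (refl , adj)) = there (here (cong (_, suc zero) (pathAdj-0 adj)))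

gridVertices : ∀ n m → List (Fin n × Fin m)
gridVertices n m = cartesianProduct (allFin n) (allFin m)

∈-gridVertices : ∀ {n m} (v : Fin n × Fin m) → v ∈ gridVertices n m
∈-gridVertices (i , j) = ∈-cartesianProduct⁺ (∈-allFin i) (∈-allFin j)

module GridGame (n m : ℕ) = FiniteGame (Grid n m) (gridVertices n m) ∈-gridVertices

grid-AliceWinsB₂ : ∀ n m → Even m ⊎ Even n → Game.AliceWinsB (Grid n m) 2
grid-AliceWinsB₂ n m (inj₁ even-m) =
  GridGame.perfectMatching⇒AliceWinsB n m (gridMatchingʳ (pathMatching m even-m))
grid-AliceWinsB₂ n m (inj₂ even-n) =
  GridGame.perfectMatching⇒AliceWinsB n m (gridMatchingˡ (pathMatching n even-n))

grid-¬AliceWinsB : ∀ {n m k} → 2 ≤ n → 2 ≤ m → 2 < k → ¬ Game.AliceWinsB (Grid n m) k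
grid-¬AliceWinsB {suc (suc n)} {suc (suc m)} {suc (suc (suc k))}
                 (s≤s (s≤s _)) (s≤s (s≤s _)) (s≤s (s≤s (s≤s _))) =
  GridGame.lowDegree⇒¬AliceWinsB _ _ k (λ ()) (λ ()) (λ ()) adj-gridCorner

ladder-¬AliceWinsA : ∀ {n k} → 2 ≤ n → 1 < k → ¬ Game.AliceWinsA (Grid n 2) k
ladder-¬AliceWinsA {suc (suc n)} {suc (suc k)} (s≤s (s≤s _)) (s≤s (s≤s _)) =
  GridGame.ladderEnd⇒¬AliceWinsA _ _ k pairing ladderEnd
  where
  open PerfectMatching (gridMatchingʳ {suc (suc n)} (pathMatching-2+ pathMatching-0)) using (pairing)
  ladderEnd : GridGame.LadderEnd (suc (suc n)) 2 pairing
  ladderEnd = record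
    { x₀ = zero , zero ; x₁ = zero , suc zero ; y₀ = suc zero , zero ; y₁ = suc zero , suc zero
    ; partner-x₀ = refl ; partner-y₀ = refl
    ; x₀≢y₀ = λ () ; x₀≢y₁ = λ () ; x₁≢y₀ = λ () ; x₁≢y₁ = λ ()
    ; N[x₀]⊆ = adj-gridCorner ; N[x₁]⊆ = adj-ladderCorner
    }

proposition5p1 : ((m n : ℕ) → 2 ≤ m → m ≤ n → (Even m ⊎ Even n) →
    DelayedGameDomaticNumberIs (Grid n m) 2)
    × ((n : ℕ) → 2 ≤ n → GameDomaticNumberIs (Grid n 2) 1)
proposition5p1 =
  (λ m n 2≤m m≤n even →
     grid-AliceWinsB₂ n m even , λ k 2<k → grid-¬AliceWinsB (≤-trans 2≤m m≤n) 2≤m 2<k)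
  , λ n 2≤n → GridGame.oneColour⇒AliceWinsA n 2 , λ k 1<k → ladder-¬AliceWinsA 2≤n 1<k
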